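{- Let $\lesssim$ be a plausible preorder on $\mathcal{T}$ and $E(\cdot|\cdot)$ the conditional expectation naturally induced by it; write $P(C|D)=E(C|D)$. Let $X$ be a random quantity and $C,D$ events. Suppose $P(C|D)=0$ and there is a real number $p$ such that $-p\lesssim_{C.D}X\lesssim_{C.D}p$. Then $E(X.C|D)=0$.
   Context: Random quantities: $\mathcal{T}$ is a unital associative commutative algebra over $\mathbb{R}$; reals $r$ are identified with $r\mathbf{1}$; products are written $X.Y$. Events: idempotents $A$ ($A.A=A$). Plausible preorder: a relation $\lesssim$ on $\mathcal{T}$ with (i) $0\lesssim A$ for every event $A$; (ii) $0\lesssim X$ and $0\lesssim Y$ imply $0\lesssim X+Y$; (iii) $0\lesssim X$ and real $q\ge0$ imply $0\lesssim qX$; (iv) $X\lesssim Y$ iff $0\lesssim Y-X$. Strict part: $X\lnsim Y$ iff $X\lesssim Y$ and not $Y\lesssim X$. Conditional preorder: $X\lesssim_C Y$ iff $X.C\lesssim Y.C$; strict part $\lnsim_C$. Expectation induced by a plausible preorder: $E(X)$ is the real $x$ if $-\epsilon\lnsim X-x\lnsim\epsilon$ for all reals $\epsilon>0$; it is $+\infty$ if $y\lnsim X$ for all reals $y$; it is $-\infty$ if $X\lnsim y$ for all reals $y$; it is undefined otherwise. Conditional expectation: $E(X|C)$ is the expectation induced by $\lesssim_C$. Conditional probability: $P(C|D)=E(C|D)$. -}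

module Defs where

open import Level using (0ℓ)
open import Data.Product using (Σ; _×_; _,_)
open import Relation.Nullary using (¬_)
open import Relation.Binary.PropositionalEquality using (_≡_)
open import Algebra.Structures using (IsCommutativeRing)
open import Relation.Binary.Structures using (IsTotalOrder)

-- The real numbers, axiomatised as a complete ordered field
-- (any model is isomorphic to ℝ).

record Reals : Set₁ where
  infixl 6 _+_
  infixl 7 _*_
  infix 4 _≤_
  field
    ℝ   : Set
    _+_ : ℝ → ℝ → ℝ
    _*_ : ℝ → ℝ → ℝ
    -_  : ℝ → ℝ
    0ℝ  : ℝ
    1ℝ  : ℝ
    _≤_ : ℝ → ℝ → Set
    isCommutativeRing : IsCommutativeRing _≡_ _+_ _*_ -_ 0ℝ 1ℝ
    0≢1     : ¬ (0ℝ ≡ 1ℝ)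
    inverse : ∀ x → ¬ (x ≡ 0ℝ) → Σ ℝ (λ y → x * y ≡ 1ℝ)
    isTotalOrder : IsTotalOrder _≡_ _≤_
    +-mono-≤ : ∀ {x y} z → x ≤ y → x + z ≤ y + z
    *-nonneg : ∀ {x y} → 0ℝ ≤ x → 0ℝ ≤ y → 0ℝ ≤ x * y
    complete : (S : ℝ → Set) → Σ ℝ S → Σ ℝ (λ b → ∀ x → S x → x ≤ b) →
               Σ ℝ (λ s → (∀ x → S x → x ≤ s) ×
                          (∀ b → (∀ x → S x → x ≤ b) → s ≤ b))

  Pos : ℝ → Set
  Pos x = (0ℝ ≤ x) × ¬ (x ≡ 0ℝ)

-- Random quantities: a unital associative commutative ℝ-algebra 𝒯.

record RAlgebra (R : Reals) : Set₁ where
  open Reals R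
  infixl 6 _⊕_
  infixl 7 _∙_
  infixr 8 _·_
  field
    T   : Set
    _⊕_ : T → T → T
    _∙_ : T → T → T
    ⊖_  : T → T
    𝟎   : T
    𝟏   : T
    _·_ : ℝ → T → T
    isCommutativeRing : IsCommutativeRing _≡_ _⊕_ _∙_ ⊖_ 𝟎 𝟏
    ·-distribˡ : ∀ r X Y → r · (X ⊕ Y) ≡ r · X ⊕ r · Y
    ·-distribʳ : ∀ r s X → (r + s) · X ≡ r · X ⊕ s · X
    ·-assoc    : ∀ r s X → (r * s) · X ≡ r · (s · X)
    ·-identity : ∀ X → 1ℝ · X ≡ X
    ·-∙        : ∀ r X Y → (r · X) ∙ Y ≡ r · (X ∙ Y)

  -- reals r are identified with r𝟏
  ⟦_⟧ : ℝ → T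
  ⟦ r ⟧ = r · 𝟏

  _⊝_ : T → T → T
  X ⊝ Y = X ⊕ ⊖ Y

  IsEvent : T → Set
  IsEvent A = A ∙ A ≡ A

  record IsPlausiblePreorder (_≲_ : T → T → Set) : Set where
    field
      event-nonneg : ∀ A → IsEvent A → 𝟎 ≲ A
      nonneg-+     : ∀ {X Y} → 𝟎 ≲ X → 𝟎 ≲ Y → 𝟎 ≲ (X ⊕ Y)
      nonneg-·     : ∀ {X} q → 𝟎 ≲ X → 0ℝ ≤ q → 𝟎 ≲ (q · X)
      ≲⇒diff       : ∀ {X Y} → X ≲ Y → 𝟎 ≲ (Y ⊝ X)
      diff⇒≲       : ∀ {X Y} → 𝟎 ≲ (Y ⊝ X) → X ≲ Y

  Strict : (T → T → Set) → T → T → Set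
  Strict _≲_ X Y = (X ≲ Y) × ¬ (Y ≲ X)

  Cond : (T → T → Set) → T → T → T → Set
  Cond _≲_ C X Y = (X ∙ C) ≲ (Y ∙ C)

  -- "E(X) is the real x" for the expectation induced by a preorder _≲_
  -- (first clause of the definition).
  ExpIs : (T → T → Set) → T → ℝ → Set
  ExpIs _≲_ X x = ∀ ε → Pos ε →
    Strict _≲_ ⟦ - ε ⟧ (X ⊝ ⟦ x ⟧) × Strict _≲_ (X ⊝ ⟦ x ⟧) ⟦ ε ⟧

  CondExpIs : (T → T → Set) → T → T → ℝ → Set
  CondExpIs _≲_ X C x = ExpIs (Cond _≲_ C) X x

  CondProbIs : (T → T → Set) → T → T → ℝ → Set
  CondProbIs _≲_ C D x = CondExpIs _≲_ C D x

-- Write K = C.D. Reading P(C|D) = 0 off the definition, K ⪇ δ.D under ≲ for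
-- every real δ > 0; rescaling by any q > 0 gives q.K ⪇ ε.D for all q, ε > 0.
-- Choosing q > 0 with p ≤ q, the hypothesis sandwiches X.K between -q.K and
-- q.K, hence X.K strictly between -ε.D and ε.D, which says E(X.C|D) = 0.
module Submission where

open import Defs
open import Level using (0ℓ)
open import Data.Product using (Σ; _×_; _,_; proj₁; proj₂)
open import Data.Sum using (inj₁; inj₂)
open import Data.Empty using (⊥-elim)
open import Relation.Nullary using (¬_)
open import Relation.Binary.PropositionalEquality
open import Relation.Binary.Structures using (IsTotalOrder)
open import Algebra.Bundles using (CommutativeRing)
import Algebra.Properties.Ring as RingProperties
import Algebra.Properties.CommutativeSemigroup as CommutativeSemigroupProperties

module OrderedField (R : Reals) where
  open Reals R
  open IsTotalOrder isTotalOrder using (total; antisym) renaming (trans to ≤-trans)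

  module ℝʳ where
    commutativeRing : CommutativeRing 0ℓ 0ℓ
    commutativeRing = record { isCommutativeRing = isCommutativeRing }
    open CommutativeRing commutativeRing public
      using (ring; +-comm; +-identityˡ; -‿inverseˡ; -‿inverseʳ; *-comm; *-assoc; *-identityˡ; zeroʳ)
    open RingProperties ring public using (-‿distribˡ-*; -‿distribʳ-*; -‿involutive)

  ≤⇒0≤-diff : ∀ {x y} → x ≤ y → 0ℝ ≤ y + - x
  ≤⇒0≤-diff {x} {y} x≤y = subst (_≤ y + - x) (ℝʳ.-‿inverseʳ x) (+-mono-≤ (- x) x≤y)

  ≤0⇒0≤- : ∀ {x} → x ≤ 0ℝ → 0ℝ ≤ - x
  ≤0⇒0≤- {x} x≤0 = subst (0ℝ ≤_) (ℝʳ.+-identityˡ (- x)) (≤⇒0≤-diff x≤0)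

  0≤1 : 0ℝ ≤ 1ℝ
  0≤1 with total 0ℝ 1ℝ
  ... | inj₁ 0≤1 = 0≤1
  ... | inj₂ 1≤0 = subst (0ℝ ≤_) -1*-1≡1 (*-nonneg 0≤-1 0≤-1)
    where
    0≤-1 : 0ℝ ≤ - 1ℝ
    0≤-1 = ≤0⇒0≤- 1≤0
    -1*-1≡1 : (- 1ℝ) * (- 1ℝ) ≡ 1ℝ
    -1*-1≡1 = begin
      (- 1ℝ) * (- 1ℝ) ≡⟨ ℝʳ.-‿distribˡ-* 1ℝ (- 1ℝ) ⟨
      - (1ℝ * (- 1ℝ)) ≡⟨ cong -_ (ℝʳ.*-identityˡ (- 1ℝ)) ⟩
      - (- 1ℝ)        ≡⟨ ℝʳ.-‿involutive 1ℝ ⟩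
      1ℝ              ∎
      where open ≡-Reasoning

  1≰0 : ¬ (1ℝ ≤ 0ℝ)
  1≰0 1≤0 = 0≢1 (antisym 0≤1 1≤0)

  x≤x+1 : ∀ x → x ≤ x + 1ℝ
  x≤x+1 x = subst₂ _≤_ (ℝʳ.+-identityˡ x) (ℝʳ.+-comm 1ℝ x) (+-mono-≤ x 0≤1)

  inverse-nonneg : ∀ {x y} → 0ℝ ≤ x → x * y ≡ 1ℝ → 0ℝ ≤ y
  inverse-nonneg {x} {y} 0≤x xy≡1 with total 0ℝ y
  ... | inj₁ 0≤y = 0≤y
  ... | inj₂ y≤0 =
    ⊥-elim (1≰0 (subst₂ _≤_ (ℝʳ.+-identityˡ 1ℝ) (ℝʳ.-‿inverseˡ 1ℝ) (+-mono-≤ 1ℝ 0≤-1)))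
    where
    0≤-1 : 0ℝ ≤ - 1ℝ
    0≤-1 = subst (0ℝ ≤_) (trans (sym (ℝʳ.-‿distribʳ-* x y)) (cong -_ xy≡1))
                 (*-nonneg 0≤x (≤0⇒0≤- y≤0))

  *-nonzero : ∀ {x y} → ¬ (x ≡ 0ℝ) → ¬ (y ≡ 0ℝ) → ¬ (x * y ≡ 0ℝ)
  *-nonzero {x} {y} x≢0 y≢0 xy≡0 with inverse x x≢0
  ... | x⁻¹ , xx⁻¹≡1 = y≢0 (begin
    y                ≡⟨ ℝʳ.*-identityˡ y ⟨
    1ℝ * y           ≡⟨ cong (_* y) (trans (ℝʳ.*-comm x⁻¹ x) xx⁻¹≡1) ⟨
    (x⁻¹ * x) * y    ≡⟨ ℝʳ.*-assoc x⁻¹ x y ⟩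
    x⁻¹ * (x * y)    ≡⟨ cong (x⁻¹ *_) xy≡0 ⟩
    x⁻¹ * 0ℝ         ≡⟨ ℝʳ.zeroʳ x⁻¹ ⟩
    0ℝ               ∎)
    where open ≡-Reasoning

  Pos-* : ∀ {x y} → Pos x → Pos y → Pos (x * y)
  Pos-* (0≤x , x≢0) (0≤y , y≢0) = *-nonneg 0≤x 0≤y , *-nonzero x≢0 y≢0

  Pos-inverse : ∀ {x y} → Pos x → x * y ≡ 1ℝ → Pos y
  Pos-inverse {x} (0≤x , _) xy≡1 =
    inverse-nonneg 0≤x xy≡1 ,
    λ y≡0 → 0≢1 (trans (sym (ℝʳ.zeroʳ x)) (trans (cong (x *_) (sym y≡0)) xy≡1))

  positive-upper-bound : ∀ x → Σ ℝ (λ q → Pos q × x ≤ q)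
  positive-upper-bound x with total x 0ℝ
  ... | inj₁ x≤0 = 1ℝ , (0≤1 , λ 1≡0 → 0≢1 (sym 1≡0)) , ≤-trans x≤0 0≤1
  ... | inj₂ 0≤x = x + 1ℝ , (≤-trans 0≤x (x≤x+1 x) , x+1≢0) , x≤x+1 x
    where
    x+1≢0 : ¬ (x + 1ℝ ≡ 0ℝ)
    x+1≢0 x+1≡0 = 1≰0 (subst₂ _≤_ (ℝʳ.+-identityˡ 1ℝ) x+1≡0 (+-mono-≤ 1ℝ 0≤x))

module Embedding (R : Reals) (A : RAlgebra R) where
  open Reals R
  open RAlgebra A
  open OrderedField R using (module ℝʳ)
  open ≡-Reasoning

  module 𝒯ʳ where
    commutativeRing : CommutativeRing 0ℓ 0ℓ
    commutativeRing = record { isCommutativeRing = RAlgebra.isCommutativeRing A }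
    open CommutativeRing commutativeRing public
      using (ring; *-commutativeSemigroup; +-assoc; +-comm; +-identityʳ; -‿inverseˡ; *-assoc; *-identityˡ)
    open RingProperties ring public
      using (-‿distribˡ-*; -‿involutive; -0#≈0#; x+x≈x⇒x≈0; +-inverseˡ-unique; x[y-z]≈xy-xz)

  ·≡⟦⟧∙ : ∀ r X → r · X ≡ ⟦ r ⟧ ∙ X
  ·≡⟦⟧∙ r X = sym (trans (·-∙ r 𝟏 X) (cong (r ·_) (𝒯ʳ.*-identityˡ X)))

  ⟦⟧∙-assoc : ∀ r s X → ⟦ r ⟧ ∙ (⟦ s ⟧ ∙ X) ≡ ⟦ r * s ⟧ ∙ X
  ⟦⟧∙-assoc r s X = begin
    ⟦ r ⟧ ∙ (⟦ s ⟧ ∙ X)   ≡⟨ 𝒯ʳ.*-assoc ⟦ r ⟧ ⟦ s ⟧ X ⟨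
    (⟦ r ⟧ ∙ ⟦ s ⟧) ∙ X   ≡⟨ cong (_∙ X) (·≡⟦⟧∙ r ⟦ s ⟧) ⟨
    (r · s · 𝟏) ∙ X       ≡⟨ cong (_∙ X) (·-assoc r s 𝟏) ⟨
    ⟦ r * s ⟧ ∙ X         ∎

  ⟦1⟧∙ : ∀ X → ⟦ 1ℝ ⟧ ∙ X ≡ X
  ⟦1⟧∙ X = trans (cong (_∙ X) (·-identity 𝟏)) (𝒯ʳ.*-identityˡ X)

  ⟦0⟧ : ⟦ 0ℝ ⟧ ≡ 𝟎
  ⟦0⟧ = 𝒯ʳ.x+x≈x⇒x≈0 ⟦ 0ℝ ⟧
          (trans (sym (·-distribʳ 0ℝ 0ℝ 𝟏)) (cong (_· 𝟏) (ℝʳ.+-identityˡ 0ℝ)))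

  ⟦-⟧ : ∀ r → ⟦ - r ⟧ ≡ ⊖ ⟦ r ⟧
  ⟦-⟧ r = 𝒯ʳ.+-inverseˡ-unique ⟦ - r ⟧ ⟦ r ⟧
    (trans (sym (·-distribʳ (- r) r 𝟏)) (trans (cong (_· 𝟏) (ℝʳ.-‿inverseˡ r)) ⟦0⟧))

  ⟦-⟧∙ : ∀ r X → ⟦ - r ⟧ ∙ X ≡ ⊖ (⟦ r ⟧ ∙ X)
  ⟦-⟧∙ r X = trans (cong (_∙ X) (⟦-⟧ r)) (sym (𝒯ʳ.-‿distribˡ-* ⟦ r ⟧ X))

  ⊝⟦0⟧ : ∀ X → X ⊝ ⟦ 0ℝ ⟧ ≡ X
  ⊝⟦0⟧ X = trans (cong (λ Z → X ⊕ ⊖ Z) ⟦0⟧)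
                 (trans (cong (X ⊕_) 𝒯ʳ.-0#≈0#) (𝒯ʳ.+-identityʳ X))

  -- _⊝_ (and, below, the preorder _≲_) has no fixity, so it binds tighter than _∙_.
  ·-distribʳ-⊝ : ∀ r s X → (r + - s) · X ≡ (⟦ r ⟧ ∙ X) ⊝ (⟦ s ⟧ ∙ X)
  ·-distribʳ-⊝ r s X = begin
    (r + - s) · X            ≡⟨ ·-distribʳ r (- s) X ⟩
    r · X ⊕ (- s) · X        ≡⟨ cong₂ _⊕_ (·≡⟦⟧∙ r X) (trans (·≡⟦⟧∙ (- s) X) (⟦-⟧∙ s X)) ⟩
    (⟦ r ⟧ ∙ X) ⊝ (⟦ s ⟧ ∙ X)  ∎

  ⊝-trans : ∀ X Y Z → (Z ⊝ Y) ⊕ (Y ⊝ X) ≡ Z ⊝ X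
  ⊝-trans X Y Z = begin
    (Z ⊕ ⊖ Y) ⊕ (Y ⊕ ⊖ X)   ≡⟨ 𝒯ʳ.+-assoc (Z ⊕ ⊖ Y) Y (⊖ X) ⟨
    ((Z ⊕ ⊖ Y) ⊕ Y) ⊕ ⊖ X   ≡⟨ cong (_⊕ ⊖ X) (𝒯ʳ.+-assoc Z (⊖ Y) Y) ⟩
    (Z ⊕ (⊖ Y ⊕ Y)) ⊕ ⊖ X   ≡⟨ cong (λ W → (Z ⊕ W) ⊕ ⊖ X) (𝒯ʳ.-‿inverseˡ Y) ⟩
    (Z ⊕ 𝟎) ⊕ ⊖ X           ≡⟨ cong (_⊕ ⊖ X) (𝒯ʳ.+-identityʳ Z) ⟩
    Z ⊕ ⊖ X                 ∎

  ⊖⊝⊖ : ∀ X Y → (⊖ X) ⊝ (⊖ Y) ≡ Y ⊝ X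
  ⊖⊝⊖ X Y = trans (cong (⊖ X ⊕_) (𝒯ʳ.-‿involutive Y)) (𝒯ʳ.+-comm (⊖ X) Y)

  IsEvent-∙ : ∀ {C D} → IsEvent C → IsEvent D → IsEvent (C ∙ D)
  IsEvent-∙ {C} {D} C∙C≡C D∙D≡D = begin
    (C ∙ D) ∙ (C ∙ D)   ≡⟨ CommutativeSemigroupProperties.interchange 𝒯ʳ.*-commutativeSemigroup C D C D ⟩
    (C ∙ C) ∙ (D ∙ D)   ≡⟨ cong₂ _∙_ C∙C≡C D∙D≡D ⟩
    C ∙ D               ∎

module PlausiblePreorder (R : Reals) (A : RAlgebra R)
    (_≲_ : RAlgebra.T A → RAlgebra.T A → Set) (P : RAlgebra.IsPlausiblePreorder A _≲_) where
  open Reals R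
  open RAlgebra A
  open IsPlausiblePreorder P
  open OrderedField R using (module ℝʳ; ≤⇒0≤-diff; Pos-*; Pos-inverse)
  open Embedding R A
  open ≡-Reasoning

  infix 4 _⪇_
  _⪇_ : T → T → Set
  _⪇_ = Strict _≲_

  ≲-trans : ∀ {X Y Z} → X ≲ Y → Y ≲ Z → X ≲ Z
  ≲-trans {X} {Y} {Z} X≲Y Y≲Z =
    diff⇒≲ (subst (𝟎 ≲_) (⊝-trans X Y Z) (nonneg-+ (≲⇒diff Y≲Z) (≲⇒diff X≲Y)))

  ≲-⪇-trans : ∀ {X Y Z} → X ≲ Y → Y ⪇ Z → X ⪇ Z
  ≲-⪇-trans X≲Y (Y≲Z , Z≴Y) = ≲-trans X≲Y Y≲Z , λ Z≲X → Z≴Y (≲-trans Z≲X X≲Y)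

  ⪇-≲-trans : ∀ {X Y Z} → X ⪇ Y → Y ≲ Z → X ⪇ Z
  ⪇-≲-trans (X≲Y , Y≴X) Y≲Z = ≲-trans X≲Y Y≲Z , λ Z≲X → Y≴X (≲-trans Y≲Z Z≲X)

  ⊖-antitone : ∀ {X Y} → X ≲ Y → (⊖ Y) ≲ (⊖ X)
  ⊖-antitone {X} {Y} X≲Y = diff⇒≲ (subst (𝟎 ≲_) (sym (⊖⊝⊖ X Y)) (≲⇒diff X≲Y))

  ⊖-strictAntitone : ∀ {X Y} → X ⪇ Y → ⊖ Y ⪇ ⊖ X
  ⊖-strictAntitone {X} {Y} (X≲Y , Y≴X) =
    ⊖-antitone X≲Y ,
    λ -X≲-Y → Y≴X (subst₂ _≲_ (𝒯ʳ.-‿involutive Y) (𝒯ʳ.-‿involutive X) (⊖-antitone -X≲-Y))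

  ⟦⟧∙-mono : ∀ {r X Y} → 0ℝ ≤ r → X ≲ Y → (⟦ r ⟧ ∙ X) ≲ (⟦ r ⟧ ∙ Y)
  ⟦⟧∙-mono {r} {X} {Y} 0≤r X≲Y =
    diff⇒≲ (subst (𝟎 ≲_) r·[Y⊝X] (nonneg-· r (≲⇒diff X≲Y) 0≤r))
    where
    r·[Y⊝X] : r · (Y ⊝ X) ≡ (⟦ r ⟧ ∙ Y) ⊝ (⟦ r ⟧ ∙ X)
    r·[Y⊝X] = trans (·≡⟦⟧∙ r (Y ⊝ X)) (𝒯ʳ.x[y-z]≈xy-xz ⟦ r ⟧ Y X)

  ⟦⟧∙-cancel : ∀ {r X Y} → Pos r → (⟦ r ⟧ ∙ X) ≲ (⟦ r ⟧ ∙ Y) → X ≲ Y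
  ⟦⟧∙-cancel {r} {X} {Y} r>0 rX≲rY with inverse r (proj₂ r>0)
  ... | r⁻¹ , rr⁻¹≡1 =
    subst₂ _≲_ (cancel X) (cancel Y) (⟦⟧∙-mono (proj₁ (Pos-inverse r>0 rr⁻¹≡1)) rX≲rY)
    where
    cancel : ∀ Z → ⟦ r⁻¹ ⟧ ∙ (⟦ r ⟧ ∙ Z) ≡ Z
    cancel Z = begin
      ⟦ r⁻¹ ⟧ ∙ (⟦ r ⟧ ∙ Z)   ≡⟨ ⟦⟧∙-assoc r⁻¹ r Z ⟩
      ⟦ r⁻¹ * r ⟧ ∙ Z         ≡⟨ cong (λ s → ⟦ s ⟧ ∙ Z) (trans (ℝʳ.*-comm r⁻¹ r) rr⁻¹≡1) ⟩
      ⟦ 1ℝ ⟧ ∙ Z              ≡⟨ ⟦1⟧∙ Z ⟩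
      Z                       ∎

  ⟦⟧∙-strictMono : ∀ {r X Y} → Pos r → X ⪇ Y → ⟦ r ⟧ ∙ X ⪇ ⟦ r ⟧ ∙ Y
  ⟦⟧∙-strictMono r>0 (X≲Y , Y≴X) =
    ⟦⟧∙-mono (proj₁ r>0) X≲Y , λ rY≲rX → Y≴X (⟦⟧∙-cancel r>0 rY≲rX)

  ⟦⟧∙-event-mono : ∀ {K p q} → IsEvent K → p ≤ q → (⟦ p ⟧ ∙ K) ≲ (⟦ q ⟧ ∙ K)
  ⟦⟧∙-event-mono {K} {p} {q} K-event p≤q =
    diff⇒≲ (subst (𝟎 ≲_) (·-distribʳ-⊝ q p K)
                  (nonneg-· (q + - p) (event-nonneg K K-event) (≤⇒0≤-diff p≤q)))

  condProbZero⇒negligible : ∀ {C D q ε} → CondProbIs _≲_ C D 0ℝ → Pos q → Pos ε →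
                            ⟦ q ⟧ ∙ (C ∙ D) ⪇ ⟦ ε ⟧ ∙ D
  condProbZero⇒negligible {C} {D} {q} {ε} P[C|D]≡0 q>0 ε>0 with inverse q (proj₂ q>0)
  ... | q⁻¹ , qq⁻¹≡1 = subst (⟦ q ⟧ ∙ (C ∙ D) ⪇_) qδD≡εD (⟦⟧∙-strictMono q>0 C∙D⪇δD)
    where
    δ : ℝ
    δ = q⁻¹ * ε
    C∙D⪇δD : C ∙ D ⪇ ⟦ δ ⟧ ∙ D
    C∙D⪇δD = subst (_⪇ ⟦ δ ⟧ ∙ D) (cong (_∙ D) (⊝⟦0⟧ C))
                   (proj₂ (P[C|D]≡0 δ (Pos-* (Pos-inverse q>0 qq⁻¹≡1) ε>0)))
    qδD≡εD : ⟦ q ⟧ ∙ (⟦ δ ⟧ ∙ D) ≡ ⟦ ε ⟧ ∙ D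
    qδD≡εD = begin
      ⟦ q ⟧ ∙ (⟦ q⁻¹ * ε ⟧ ∙ D)   ≡⟨ ⟦⟧∙-assoc q δ D ⟩
      ⟦ q * (q⁻¹ * ε) ⟧ ∙ D       ≡⟨ cong (λ s → ⟦ s ⟧ ∙ D) (ℝʳ.*-assoc q q⁻¹ ε) ⟨
      ⟦ (q * q⁻¹) * ε ⟧ ∙ D       ≡⟨ cong (λ s → ⟦ s * ε ⟧ ∙ D) qq⁻¹≡1 ⟩
      ⟦ 1ℝ * ε ⟧ ∙ D              ≡⟨ cong (λ s → ⟦ s ⟧ ∙ D) (ℝʳ.*-identityˡ ε) ⟩
      ⟦ ε ⟧ ∙ D                   ∎

mainTheorem4 : (R : Reals) → (A : RAlgebra R) →
    let open Reals R
        open RAlgebra A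
    in (_≲_ : T → T → Set) → IsPlausiblePreorder _≲_ →
       (X C D : T) → IsEvent C → IsEvent D →
       CondProbIs _≲_ C D 0ℝ →
       Σ ℝ (λ p → Cond _≲_ (C ∙ D) ⟦ - p ⟧ X × Cond _≲_ (C ∙ D) X ⟦ p ⟧) →
       CondExpIs _≲_ (X ∙ C) D 0ℝ
mainTheorem4 R A _≲_ P X C D C-event D-event P[C|D]≡0 (p , -pK≲XK , XK≲pK) ε ε>0
  with OrderedField.positive-upper-bound R p
... | q , q>0 , p≤q =
    subst₂ _⪇_ (sym (⟦-⟧∙ ε D)) (sym XC∙D≡XK) (⪇-≲-trans (⊖-strictAntitone qK⪇εD) -qK≲XK)
  , subst (_⪇ ⟦ ε ⟧ ∙ D) (sym XC∙D≡XK) (≲-⪇-trans XK≲qK qK⪇εD)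
  where
  open Reals R
  open RAlgebra A
  open Embedding R A
  open PlausiblePreorder R A _≲_ P
  qK⪇εD : ⟦ q ⟧ ∙ (C ∙ D) ⪇ ⟦ ε ⟧ ∙ D
  qK⪇εD = condProbZero⇒negligible P[C|D]≡0 q>0 ε>0
  pK≲qK : (⟦ p ⟧ ∙ (C ∙ D)) ≲ (⟦ q ⟧ ∙ (C ∙ D))
  pK≲qK = ⟦⟧∙-event-mono (IsEvent-∙ C-event D-event) p≤q
  XK≲qK : (X ∙ (C ∙ D)) ≲ (⟦ q ⟧ ∙ (C ∙ D))
  XK≲qK = ≲-trans XK≲pK pK≲qK
  -qK≲XK : (⊖ (⟦ q ⟧ ∙ (C ∙ D))) ≲ (X ∙ (C ∙ D))
  -qK≲XK = ≲-trans (subst ((⊖ (⟦ q ⟧ ∙ (C ∙ D))) ≲_) (sym (⟦-⟧∙ p (C ∙ D))) (⊖-antitone pK≲qK))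
                   -pK≲XK
  XC∙D≡XK : ((X ∙ C) ⊝ ⟦ 0ℝ ⟧) ∙ D ≡ X ∙ (C ∙ D)
  XC∙D≡XK = trans (cong (_∙ D) (⊝⟦0⟧ (X ∙ C))) (𝒯ʳ.*-assoc X C D)
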